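{- Let $G$ be a connected finite simple graph without isolated vertices. Then Dom has a winning strategy in the Sepy-start Disjoint Domination Game on $G$.
   Context: For a vertex $v$, $N[v]$ denotes its closed neighborhood. The Disjoint Domination Game (DDG) on an isolate-free graph $G=(V,E)$ is played by two players, Dom and Sepy, who alternately choose a previously uncolored vertex $v$ and assign it one of the two colors purple or blue (either player may use either color). Let $V_p$, $V_b$ denote the current sets of purple and blue vertices. Coloring $v$ with color $c$ is a legal move iff $v\notin V_p\cup V_b$ and there exists $u\in N[v]$ with $N[u]\cap V_c=\emptyset$ (i.e. some vertex of $N[v]$ is not yet dominated in color $c$). A player must make a legal move on his turn (no passing). The game terminates as soon as either (s) some vertex $v$ has its whole closed neighborhood $N[v]$ colored with one single color, in which case Sepy wins, or (d) both $V_p$ and $V_b$ are dominating sets of $G$, in which case Dom wins. In the Sepy-start game Sepy makes the first move. -}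

module Defs where

open import Data.Nat using (ℕ)
open import Data.Fin using (Fin; _≟_)
open import Data.Bool using (Bool; true; false; if_then_else_)
open import Data.Maybe using (Maybe; just; nothing)
open import Data.Product using (Σ; ∃; _×_; _,_)
open import Data.Sum using (_⊎_)
open import Relation.Nullary using (¬_; does)
open import Relation.Binary.PropositionalEquality using (_≡_; _≢_)

record SimpleGraph (n : ℕ) : Set where
  field
    adj     : Fin n → Fin n → Bool
    symm    : ∀ u v → adj u v ≡ adj v u
    irrefl  : ∀ v → adj v v ≡ false

module _ {n : ℕ} (G : SimpleGraph n) where
  open SimpleGraph G

  data Reach (u : Fin n) : Fin n → Set where
    here : Reach u u
    step : ∀ {v w} → Reach u v → adj v w ≡ true → Reach u w

  Connected : Set
  Connected = ∀ u v → Reach u v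

  IsolateFree : Set
  IsolateFree = ∀ v → ∃ λ u → adj v u ≡ true

  InClosedNbhd : Fin n → Fin n → Set
  InClosedNbhd u w = (w ≡ u) ⊎ (adj u w ≡ true)

data Color : Set where
  purple blue : Color

Coloring : ℕ → Set
Coloring n = Fin n → Maybe Color

data Player : Set where
  dom sepy : Player

module _ {n : ℕ} (G : SimpleGraph n) where

  Undominated : Coloring n → Color → Fin n → Set
  Undominated col c u = ∀ w → InClosedNbhd G u w → col w ≢ just c

  Dominating : Coloring n → Color → Set
  Dominating col c = ∀ u → ¬ Undominated col c u

  Legal : Coloring n → Fin n → Color → Set
  Legal col v c = (col v ≡ nothing) × (∃ λ u → InClosedNbhd G v u × Undominated col c u)

  play : Coloring n → Fin n → Color → Coloring n
  play col v c w = if does (w ≟ v) then just c else col w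

  SepyWon : Coloring n → Set
  SepyWon col = ∃ λ v → ∃ λ c → ∀ w → InClosedNbhd G v w → col w ≡ just c

  DomWon : Coloring n → Set
  DomWon col = Dominating col purple × Dominating col blue

  data DomWins : Player → Coloring n → Set where
    done     : ∀ {p col} → DomWon col → DomWins p col
    domMove  : ∀ {col} → ¬ SepyWon col → ¬ DomWon col →
               (v : Fin n) (c : Color) → Legal col v c →
               DomWins sepy (play col v c) → DomWins dom col
    sepyMove : ∀ {col} → ¬ SepyWon col → ¬ DomWon col →
               (∀ v c → Legal col v c → DomWins dom (play col v c)) →
               DomWins sepy col

  empty : Coloring n
  empty _ = nothing

  DomWinsSepyStart : Set
  DomWinsSepyStart = DomWins sepy empty

-- Dom keeps every coloured vertex adjacent to a vertex of the opposite colour; then no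
-- closed neighbourhood is monochromatic, so Sepy cannot win. After a legal Sepy move
-- (w, c), either w already has a neighbour coloured opposite to c, and any move keeping
-- the invariant will do, or w has an uncoloured neighbour x (legality forbids all
-- neighbours of w carrying c), which Dom colours opposite to c. Such a move exists until
-- Dom has won: an undominated vertex u is uncoloured; if it has a neighbour of the colour
-- missing at u, Dom colours u with that missing colour; otherwise N[u] is blank, and a walk
-- from a coloured vertex to u passes an uncoloured vertex adjacent both to a coloured
-- vertex and to a vertex with blank closed neighbourhood. Each round colours two
-- vertices, so the game ends, necessarily with Dom's win.
module Submission where

open import Defs
open import Data.Nat using (ℕ; zero; suc; _+_; _≤_; s≤s)
open import Data.Nat.Properties using (≤-refl; ≤-trans; ≤-reflexive; n≤1+n; +-suc)
open import Data.Fin using (Fin; _≟_) renaming (zero to fzero; suc to fsuc)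
open import Data.Fin.Properties using (any?; all?; ¬∀⟶∃¬; suc-injective)
open import Data.Bool using (true)
import Data.Bool.Properties as Bool
open import Data.Maybe using (Maybe; just; nothing)
open import Data.Maybe.Properties using (just-injective) renaming (≡-dec to ≡-dec-Maybe)
open import Data.Product using (∃; ∃₂; _×_; _,_; proj₁)
open import Data.Sum using (_⊎_; inj₁; inj₂)
open import Data.Empty using (⊥-elim)
open import Function using (_∘_)
open import Relation.Nullary using (¬_; Dec; yes; no)
open import Relation.Nullary.Decidable using (_×-dec_; _→-dec_; _⊎-dec_; ¬?; decidable-stable)
open import Relation.Unary using (Pred; Decidable)
open import Relation.Binary.Definitions using (DecidableEquality)
open import Relation.Binary.PropositionalEquality using (_≡_; _≢_; refl; sym; trans; cong; cong₂)

opposite : Color → Color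
opposite purple = blue
opposite blue   = purple

opposite-involutive : ∀ c → opposite (opposite c) ≡ c
opposite-involutive purple = refl
opposite-involutive blue   = refl

opposite-≢ : ∀ c → opposite c ≢ c
opposite-≢ purple ()
opposite-≢ blue   ()

same-or-opposite : ∀ c e → e ≡ c ⊎ e ≡ opposite c
same-or-opposite purple purple = inj₁ refl
same-or-opposite purple blue   = inj₂ refl
same-or-opposite blue   purple = inj₂ refl
same-or-opposite blue   blue   = inj₁ refl

_≟ᶜ_ : DecidableEquality Color
purple ≟ᶜ purple = yes refl
purple ≟ᶜ blue   = no λ ()
blue   ≟ᶜ purple = no λ ()
blue   ≟ᶜ blue   = yes refl

_≟ᵐ_ : DecidableEquality (Maybe Color)
_≟ᵐ_ = ≡-dec-Maybe _≟ᶜ_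

nothing≢just : ∀ {A : Set} {a : A} → nothing ≢ just a
nothing≢just ()

≢nothing⇒just : ∀ {A : Set} {m : Maybe A} → m ≢ nothing → ∃ λ a → m ≡ just a
≢nothing⇒just {m = just a}  _  = a , refl
≢nothing⇒just {m = nothing} m≢ = ⊥-elim (m≢ refl)

≢both⇒nothing : ∀ {m : Maybe Color} c → m ≢ just c → m ≢ just (opposite c) → m ≡ nothing
≢both⇒nothing {nothing} c _ _ = refl
≢both⇒nothing {just e}  c ≢c ≢c′ with same-or-opposite c e
... | inj₁ refl = ⊥-elim (≢c refl)
... | inj₂ refl = ⊥-elim (≢c′ refl)

≢nothing-≢opposite⇒just : ∀ {m : Maybe Color} c → m ≢ nothing → m ≢ just (opposite c) → m ≡ just c
≢nothing-≢opposite⇒just c m≢ ≢c′ with ≢nothing⇒just m≢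
... | e , refl with same-or-opposite c e
...   | inj₁ refl = refl
...   | inj₂ refl = ⊥-elim (≢c′ refl)

nothingIndicator : ∀ {A : Set} → Maybe A → ℕ
nothingIndicator nothing  = 1
nothingIndicator (just _) = 0

countNothing : ∀ {A : Set} {m} → (Fin m → Maybe A) → ℕ
countNothing {m = zero}  f = 0
countNothing {m = suc m} f = nothingIndicator (f fzero) + countNothing (f ∘ fsuc)

countNothing-cong : ∀ {A : Set} {m} {f g : Fin m → Maybe A} →
                    (∀ i → f i ≡ g i) → countNothing f ≡ countNothing g
countNothing-cong {m = zero}  f≗g = refl
countNothing-cong {m = suc m} f≗g =
  cong₂ _+_ (cong nothingIndicator (f≗g fzero))
            (countNothing-cong (f≗g ∘ fsuc))

countNothing-fill : ∀ {A : Set} {m} (f g : Fin m → Maybe A) (v : Fin m) {a : A} →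
                    f v ≡ nothing → g v ≡ just a → (∀ w → w ≢ v → g w ≡ f w) →
                    suc (countNothing g) ≡ countNothing f
countNothing-fill {m = suc m} f g fzero fv gv g≗f rewrite fv | gv =
  cong suc (countNothing-cong (λ i → g≗f (fsuc i) λ ()))
countNothing-fill {m = suc m} f g (fsuc v) fv gv g≗f
  rewrite g≗f fzero (λ ())
        | sym (countNothing-fill (f ∘ fsuc) (g ∘ fsuc) v fv gv
                 (λ w w≢v → g≗f (fsuc w) (w≢v ∘ suc-injective)))
  = sym (+-suc _ _)

module _ {n : ℕ} (G : SimpleGraph n) where
  open SimpleGraph G

  adj-sym : ∀ {u v} → adj u v ≡ true → adj v u ≡ true
  adj-sym {u} {v} uv = trans (symm v u) uv

  adj⇒≢ : ∀ {u v} → adj u v ≡ true → v ≢ u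
  adj⇒≢ {u} uv refl with trans (sym (irrefl u)) uv
  ... | ()

  play-≡ : ∀ col v c → play G col v c v ≡ just c
  play-≡ col v c with v ≟ v
  ... | yes _   = refl
  ... | no v≢v = ⊥-elim (v≢v refl)

  play-≢ : ∀ col c {v w} → w ≢ v → play G col v c w ≡ col w
  play-≢ col c {v} {w} w≢v with w ≟ v
  ... | yes w≡v = ⊥-elim (w≢v w≡v)
  ... | no _    = refl

  play-keeps : ∀ col c {v w e} → col v ≡ nothing → col w ≡ just e → play G col v c w ≡ just e
  play-keeps col c cv cw = trans (play-≢ col c λ { refl → nothing≢just (trans (sym cv) cw) }) cw

  countNothing-play : ∀ col {v} c → col v ≡ nothing →
                      suc (countNothing (play G col v c)) ≡ countNothing col
  countNothing-play col {v} c cv =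
    countNothing-fill col (play G col v c) v cv (play-≡ col v c) (λ _ → play-≢ col c)

  neighbour? : ∀ {ℓ} {P : Pred (Fin n) ℓ} → Decidable P →
               ∀ u → Dec (∃ λ z → adj u z ≡ true × P z)
  neighbour? P? u = any? λ z → (adj u z Bool.≟ true) ×-dec P? z

  undominated? : ∀ col c u → Dec (Undominated G col c u)
  undominated? col c u = all? λ w → inClosedNbhd? w →-dec ¬? (col w ≟ᵐ just c)
    where
      inClosedNbhd? : ∀ w → Dec (InClosedNbhd G u w)
      inClosedNbhd? w = (w ≟ u) ⊎-dec (adj u w Bool.≟ true)

  dominating? : ∀ col c → Dec (Dominating G col c)
  dominating? col c = all? λ u → ¬? (undominated? col c u)

  domWon? : ∀ col → Dec (DomWon G col)
  domWon? col = dominating? col purple ×-dec dominating? col blue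

  ¬dominating⇒undominated : ∀ {col c} → ¬ Dominating G col c → ∃ (Undominated G col c)
  ¬dominating⇒undominated {col} {c} ¬dom
    with ¬∀⟶∃¬ n _ (λ u → ¬? (undominated? col c u)) ¬dom
  ... | u , ¬¬und = u , decidable-stable (undominated? col c u) ¬¬und

  ¬domWon⇒undominated : ∀ {col} → ¬ DomWon G col → ∃₂ λ c u → Undominated G col c u
  ¬domWon⇒undominated {col} ¬won with dominating? col purple
  ... | no ¬p = purple , ¬dominating⇒undominated ¬p
  ... | yes p = blue , ¬dominating⇒undominated (λ b → ¬won (p , b))

  OppositeNeighbour : Coloring n → Fin n → Color → Set
  OppositeNeighbour col y e = ∃ λ z → adj y z ≡ true × col z ≡ just (opposite e)

  Partnered : Coloring n → Set
  Partnered col = ∀ y e → col y ≡ just e → OppositeNeighbour col y e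

  Anchored : Coloring n → Fin n → Color → Set
  Anchored col x d = Legal G col x d × OppositeNeighbour col x d

  PartneredMove : Coloring n → Set
  PartneredMove col = ∃₂ λ x d → Legal G col x d × Partnered (play G col x d)

  Blank : Coloring n → Fin n → Set
  Blank col b = ∀ z → InClosedNbhd G b z → col z ≡ nothing

  partnered⇒¬sepyWon : ∀ {col} → Partnered col → ¬ SepyWon G col
  partnered⇒¬sepyWon partnered (v , c , mono) with partnered v c (mono v (inj₁ refl))
  ... | z , vz , cz = opposite-≢ c (just-injective (trans (sym cz) (mono z (inj₂ vz))))

  anchored⇒partnered : ∀ {col x d} → Partnered col → Anchored col x d → Partnered (play G col x d)
  anchored⇒partnered {col} {x} {d} partnered ((cx , _) , z , xz , cz) y e cy with y ≟ x
  ... | yes refl with just-injective cy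
  ...   | refl = z , xz , play-keeps col d cx cz
  anchored⇒partnered {col} {x} {d} partnered ((cx , _) , _) y e cy | no y≢x
    with partnered y e cy
  ... | z , yz , cz = z , yz , play-keeps col d cx cz

  partnered-colourEdge : ∀ {col w x c} → Partnered col → col w ≡ nothing → col x ≡ nothing →
                         adj w x ≡ true → Partnered (play G (play G col w c) x (opposite c))
  partnered-colourEdge {col} {w} {x} {c} partnered cw cx wx y e cy with y ≟ x | y ≟ w
  ... | yes refl | _ with just-injective cy
  ...   | refl = w , adj-sym wx ,
                 trans (play-≢ (play G col w c) (opposite c) (adj⇒≢ wx ∘ sym))
                       (trans (play-≡ col w c) (cong just (sym (opposite-involutive c))))
  partnered-colourEdge {col} {w} {x} {c} partnered cw cx wx y e cy | no y≢x | yes refl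
    with just-injective cy
  ... | refl = x , wx , play-≡ (play G col w c) x (opposite c)
  partnered-colourEdge {col} {w} {x} {c} partnered cw cx wx y e cy | no y≢x | no y≢w
    with partnered y e cy
  ... | z , yz , cz = z , yz , play-keeps (play G col w c) (opposite c)
                                 (trans (play-≢ col c (adj⇒≢ wx)) cx) (play-keeps col c cw cz)

  undominated⇒uncoloured : ∀ {col c u} → Partnered col → Undominated G col c u → col u ≡ nothing
  undominated⇒uncoloured {col} {c} {u} partnered und = ≢both⇒nothing c (und u (inj₁ refl)) ≢c′
    where
      ≢c′ : col u ≢ just (opposite c)
      ≢c′ cu with partnered u (opposite c) cu
      ... | z , uz , cz = und z (inj₂ uz) (trans cz (cong just (opposite-involutive c)))

  blank⇒undominated : ∀ {col b c} → Blank col b → Undominated G col c b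
  blank⇒undominated blank z bz cz with trans (sym (blank z bz)) cz
  ... | ()

  -- Walking back from b, the first vertex with a coloured neighbour is the anchor.
  frontier : ∀ {col a b} → Reach G a b → col a ≢ nothing → Blank col b → ∃₂ (Anchored col)
  frontier here ca blank = ⊥-elim (ca (blank _ (inj₁ refl)))
  frontier {col} {b = b} (step {v} a⇝v vb) ca blank
    with neighbour? (λ z → ¬? (col z ≟ᵐ nothing)) v
  ... | yes (q , vq , cq) with ≢nothing⇒just cq
  ...   | e , cq≡e = v , opposite e , (cv , b , inj₂ vb , blank⇒undominated blank) ,
                     q , vq , trans cq≡e (cong just (sym (opposite-involutive e)))
    where
      cv : col v ≡ nothing
      cv = blank v (inj₂ (adj-sym vb))
  frontier {col} {b = b} (step {v} a⇝v vb) ca blank | no ¬coloured = frontier a⇝v ca blank-v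
    where
      blank-v : Blank col v
      blank-v z (inj₁ refl) = blank v (inj₂ (adj-sym vb))
      blank-v z (inj₂ vz)   =
        decidable-stable (col z ≟ᵐ nothing) (λ cz → ¬coloured (z , vz , cz))

  partneredMove-exists : ∀ {col w} → Connected G → Partnered col → ¬ DomWon G col →
                         col w ≢ nothing → PartneredMove col
  partneredMove-exists {col} {w} connected partnered ¬won cw with ¬domWon⇒undominated ¬won
  ... | d , u , und with neighbour? (λ z → col z ≟ᵐ just (opposite d)) u
  ...   | yes nb = u , d , legal , anchored⇒partnered partnered (legal , nb)
    where
      legal : Legal G col u d
      legal = undominated⇒uncoloured partnered und , u , inj₁ refl , und
  ...   | no ¬nb with frontier (connected w u) cw blank-u
    where
      blank-u : Blank col u
      blank-u z (inj₁ refl) = undominated⇒uncoloured partnered und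
      blank-u z (inj₂ uz)   = ≢both⇒nothing d (und z (inj₂ uz)) (λ cz → ¬nb (z , uz , cz))
  ...     | x , d′ , anchored = x , d′ , proj₁ anchored , anchored⇒partnered partnered anchored

  legal⇒¬monochromatic : ∀ {col w c} → IsolateFree G → Legal G col w c →
                         ¬ (∀ z → adj w z ≡ true → col z ≡ just c)
  legal⇒¬monochromatic {w = w} isolateFree (_ , .w , inj₁ refl , und) mono
    with isolateFree w
  ... | z , wz = und z (inj₂ wz) (mono z wz)
  legal⇒¬monochromatic isolateFree (_ , u , inj₂ wu , und) mono = und u (inj₁ refl) (mono u wu)

  legal⇒¬sepyWon : ∀ {col w c} → IsolateFree G → Partnered col → Legal G col w c →
                   ¬ SepyWon G (play G col w c)
  legal⇒¬sepyWon {col} {w} {c} isolateFree partnered legal (v , c′ , mono) with v ≟ w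
  ... | no v≢w with partnered v c′ (trans (sym (play-≢ col c v≢w)) (mono v (inj₁ refl)))
  ...   | z , vz , cz =
    opposite-≢ c′
      (just-injective (trans (sym (play-keeps col c (proj₁ legal) cz)) (mono z (inj₂ vz))))
  legal⇒¬sepyWon {col} {w} {c} isolateFree partnered legal (v , c′ , mono) | yes refl
    with just-injective (trans (sym (play-≡ col v c)) (mono v (inj₁ refl)))
  ... | refl = legal⇒¬monochromatic isolateFree legal
                 (λ z vz → trans (sym (play-≢ col c (adj⇒≢ vz))) (mono z (inj₂ vz)))

  partneredMove-afterLegal : ∀ {col w c} → Connected G → IsolateFree G → Partnered col →
                             Legal G col w c → ¬ DomWon G (play G col w c) →
                             PartneredMove (play G col w c)
  partneredMove-afterLegal {col} {w} {c} connected isolateFree partnered legal ¬won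
    with neighbour? (λ z → col z ≟ᵐ just (opposite c)) w
  ... | yes nb = partneredMove-exists connected (anchored⇒partnered partnered (legal , nb)) ¬won
                   (λ cw → nothing≢just (trans (sym cw) (play-≡ col w c)))
  ... | no ¬opp with neighbour? (λ z → col z ≟ᵐ nothing) w
  ...   | yes (x , wx , cx) =
    x , opposite c ,
    (trans (play-≢ col c (adj⇒≢ wx)) cx , w , inj₂ (adj-sym wx) , undominated-w) ,
    partnered-colourEdge partnered (proj₁ legal) cx wx
    where
      undominated-w : Undominated G (play G col w c) (opposite c) w
      undominated-w z (inj₁ refl) cz =
        opposite-≢ c (just-injective (trans (sym cz) (play-≡ col w c)))
      undominated-w z (inj₂ wz)   cz = ¬opp (z , wz , trans (sym (play-≢ col c (adj⇒≢ wz))) cz)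
  ...   | no ¬blank = ⊥-elim (legal⇒¬monochromatic isolateFree legal λ z wz →
      ≢nothing-≢opposite⇒just c (λ cz → ¬blank (z , wz , cz)) (λ cz → ¬opp (z , wz , cz)))

  module _ (connected : Connected G) (isolateFree : IsolateFree G) where
    mutual
      partnered⇒domWins : ∀ k {col} → countNothing col ≤ k → Partnered col →
                          DomWins G sepy col
      partnered⇒domWins k {col} bound partnered with domWon? col
      ... | yes won = done won
      ... | no ¬won = sepyMove (partnered⇒¬sepyWon partnered) ¬won λ v c legal →
        partnered-legal⇒domWins k
          (≤-trans (≤-reflexive (countNothing-play col c (proj₁ legal))) bound) partnered legal

      partnered-legal⇒domWins : ∀ k {col v c} → suc (countNothing (play G col v c)) ≤ k →
                                Partnered col → Legal G col v c → DomWins G dom (play G col v c)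
      partnered-legal⇒domWins (suc k) {col} {v} {c} (s≤s bound) partnered legal
        with domWon? (play G col v c)
      ... | yes won = done won
      ... | no ¬won with partneredMove-afterLegal connected isolateFree partnered legal ¬won
      ...   | x , d , legal′ , partnered′ =
        domMove (legal⇒¬sepyWon isolateFree partnered legal) ¬won x d legal′
          (partnered⇒domWins k (≤-trans (n≤1+n _) (≤-trans decrease bound)) partnered′)
        where
          decrease : suc (countNothing (play G (play G col v c) x d)) ≤ countNothing (play G col v c)
          decrease = ≤-reflexive (countNothing-play (play G col v c) d (proj₁ legal′))

mainTheorem1 : (n : ℕ) (G : SimpleGraph n) → Connected G → IsolateFree G →
    DomWinsSepyStart G
mainTheorem1 n G connected isolateFree =
  partnered⇒domWins G connected isolateFree _ ≤-refl (λ _ _ ())
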